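{- Let $X$ be a T$_D$ space. Then every instance of $\mathrm{M}$ is $d$-valid in $X$ if and only if $X$ is crowded and openly irresolvable. Consequently, if $X$ is T$_D$ and crowded, then the following are equivalent: every instance of $\mathrm{M}$ is $d$-valid in $X$; $X$ is openly irresolvable; every instance of $\mathrm{M}$ is $C$-valid in $X$.
   Context: Modal formulas are built from propositional variables using $\top,\bot,\neg,\land,\lor,\to,\Diamond,\Box$. The McKinsey scheme $\mathrm{M}$ consists of all formulas $\Box\Diamond\varphi\to\Diamond\Box\varphi$ (equivalently $\Diamond(\Box\varphi\lor\Box\neg\varphi)$). A topological model on $X$ assigns a subset of $X$ to each variable, Boolean connectives being interpreted by set operations. In $d$-semantics $\Diamond\varphi$ is interpreted as the derived set (set of limit points) of the truth set of $\varphi$ and $\Box\varphi$ as $\neg\Diamond\neg\varphi$; in $C$-semantics $\Diamond\varphi$ is interpreted as the closure of the truth set of $\varphi$ and $\Box\varphi$ as its interior. A formula is $d$-valid (resp. $C$-valid) in $X$ if its $d$-truth set (resp. $C$-truth set) is $X$ in every model on $X$. $X$ is T$_D$ if the derived set of every singleton is closed; crowded if it has no isolated points. A space is resolvable if it has two disjoint non-empty dense subsets, irresolvable otherwise; $X$ is openly irresolvable if every non-empty open subspace of $X$ is irresolvable. -}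

module Defs where

open import Level using (Level; Lift; 0ℓ) renaming (suc to lsuc)
open import Data.Nat using (ℕ)
open import Data.Unit using (⊤)
open import Data.Empty using (⊥)
open import Data.Product using (Σ; ∃; _×_)
open import Data.Sum using (_⊎_)
open import Relation.Nullary using (¬_)
open import Relation.Binary.PropositionalEquality using (_≡_; _≢_)
open import Function.Bundles using (_⇔_)

-- Open sets are level-0 predicates on the carrier; arbitrary subsets
-- (truth sets of formulas, valuations, resolving sets) are level-1
-- predicates, so that derived set / closure / interior (which quantify
-- over all open sets) are again subsets.

Subset : Set → Set₂
Subset X = X → Set₁

record Space : Set₂ where
  field
    Pt        : Set
    IsOpen    : (Pt → Set) → Set₁
    open-ext  : (U V : Pt → Set) → (∀ x → U x ⇔ V x) → IsOpen U → IsOpen V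
    open-univ : IsOpen (λ _ → ⊤)
    open-∩    : (U V : Pt → Set) → IsOpen U → IsOpen V → IsOpen (λ x → U x × V x)
    open-⋃    : (I : Set) (U : I → Pt → Set) → (∀ i → IsOpen (U i)) →
                IsOpen (λ x → Σ I (λ i → U i x))

module _ (X : Space) where
  open Space X

  IsOpenSub : Subset Pt → Set₁
  IsOpenSub A = Σ (Pt → Set) λ U → IsOpen U × (∀ x → U x ⇔ A x)

  IsClosed : Subset Pt → Set₁
  IsClosed A = IsOpenSub (λ x → ¬ A x)

  derived : Subset Pt → Subset Pt
  derived A x = (U : Pt → Set) → IsOpen U → U x → ∃ λ y → U y × A y × y ≢ x

  closure : Subset Pt → Subset Pt
  closure A x = (U : Pt → Set) → IsOpen U → U x → ∃ λ y → U y × A y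

  interior : Subset Pt → Subset Pt
  interior A x = Σ (Pt → Set) λ U → IsOpen U × U x × (∀ y → U y → A y)

  singleton : Pt → Subset Pt
  singleton x y = Lift _ (y ≡ x)

  TD : Set₁
  TD = ∀ x → IsClosed (derived (singleton x))

  Crowded : Set₁
  Crowded = ∀ x → ¬ IsOpen (λ y → y ≡ x)

  -- A is dense in the subspace U (relative topology: opens W ∩ U)
  DenseIn : (Pt → Set) → Subset Pt → Set₁
  DenseIn U A = ∀ x → U x → (W : Pt → Set) → IsOpen W → W x →
                ∃ λ y → W y × U y × A y

  ResolvableSub : (Pt → Set) → Set₂
  ResolvableSub U = Σ (Subset Pt) λ A → Σ (Subset Pt) λ B →
      (∀ x → A x → U x) × (∀ x → B x → U x)
    × (∃ λ x → A x) × (∃ λ x → B x)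
    × (∀ x → A x → B x → ⊥)
    × DenseIn U A × DenseIn U B

  OpenlyIrresolvable : Set₂
  OpenlyIrresolvable = (U : Pt → Set) → IsOpen U → (∃ λ x → U x) → ¬ ResolvableSub U

data Fm : Set where
  var       : ℕ → Fm
  ⊤ᶠ ⊥ᶠ     : Fm
  ¬ᶠ_       : Fm → Fm
  _∧ᶠ_ _∨ᶠ_ _⇒ᶠ_ : Fm → Fm → Fm
  ◇_ □_     : Fm → Fm

McK : Fm → Fm
McK φ = (□ (◇ φ)) ⇒ᶠ (◇ (□ φ))

module _ (X : Space) where
  open Space X

  Valuation : Set₂
  Valuation = ℕ → Subset Pt

  ⟦_⟧d : Fm → Valuation → Subset Pt
  ⟦ var n ⟧d  v x = v n x
  ⟦ ⊤ᶠ ⟧d     v x = Lift _ ⊤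
  ⟦ ⊥ᶠ ⟧d     v x = Lift _ ⊥
  ⟦ ¬ᶠ φ ⟧d   v x = ¬ ⟦ φ ⟧d v x
  ⟦ φ ∧ᶠ ψ ⟧d v x = ⟦ φ ⟧d v x × ⟦ ψ ⟧d v x
  ⟦ φ ∨ᶠ ψ ⟧d v x = ⟦ φ ⟧d v x ⊎ ⟦ ψ ⟧d v x
  ⟦ φ ⇒ᶠ ψ ⟧d v x = ⟦ φ ⟧d v x → ⟦ ψ ⟧d v x
  ⟦ ◇ φ ⟧d    v x = derived X (⟦ φ ⟧d v) x
  ⟦ □ φ ⟧d    v x = ¬ derived X (λ y → ¬ ⟦ φ ⟧d v y) x

  ⟦_⟧C : Fm → Valuation → Subset Pt
  ⟦ var n ⟧C  v x = v n x
  ⟦ ⊤ᶠ ⟧C     v x = Lift _ ⊤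
  ⟦ ⊥ᶠ ⟧C     v x = Lift _ ⊥
  ⟦ ¬ᶠ φ ⟧C   v x = ¬ ⟦ φ ⟧C v x
  ⟦ φ ∧ᶠ ψ ⟧C v x = ⟦ φ ⟧C v x × ⟦ ψ ⟧C v x
  ⟦ φ ∨ᶠ ψ ⟧C v x = ⟦ φ ⟧C v x ⊎ ⟦ ψ ⟧C v x
  ⟦ φ ⇒ᶠ ψ ⟧C v x = ⟦ φ ⟧C v x → ⟦ ψ ⟧C v x
  ⟦ ◇ φ ⟧C    v x = closure X (⟦ φ ⟧C v) x
  ⟦ □ φ ⟧C    v x = interior X (⟦ φ ⟧C v) x

  dValid : Fm → Set₂
  dValid φ = (v : Valuation) → ∀ x → ⟦ φ ⟧d v x

  CValid : Fm → Set₂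
  CValid φ = (v : Valuation) → ∀ x → ⟦ φ ⟧C v x

  McKinsey-d : Set₂
  McKinsey-d = ∀ φ → dValid (McK φ)

  McKinsey-C : Set₂
  McKinsey-C = ∀ φ → CValid (McK φ)

-- Write □ᵈ, ◇ᵈ for the d-operators (◇ᵈ taking derived sets) and Int, Cl for
-- interior and closure.  In a crowded space □ᵈ◇ᵈA ⊆ Int Cl A and
-- Cl Int A ⊆ ◇ᵈ□ᵈA, so the d-instances of M follow from the C-instances
-- Int Cl A ⊆ Cl Int A.  These hold in an openly irresolvable space: A is dense
-- in the open set O = Int Cl A ∩ V, and if A had empty interior within O, its
-- complement would be dense in O as well, resolving O.  Conversely a
-- resolution A, B of a non-empty open U refutes M at every point of U, since
-- U ⊆ Cl A while B, dense in U and disjoint from A, keeps Int A off U.  In the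
-- d-semantics this needs a set dense in an open U to accumulate at every point
-- of U, which is where T_D enters; and M fails at isolated points, which forces
-- crowdedness.
module Submission where

open import Defs
open import Level using (Level; Lift; lift)
open import Data.Product using (_×_; Σ; ∃; _,_; proj₁; proj₂)
open import Data.Unit using (⊤; tt)
open import Relation.Nullary using (¬_)
open import Relation.Binary.PropositionalEquality using (_≡_; _≢_; refl; sym; subst)
open import Function.Bundles using (_⇔_; mk⇔; Equivalence)
open import Axiom.ExcludedMiddle using (ExcludedMiddle)
open import Axiom.DoubleNegationElimination using (DoubleNegationElimination; em⇒dne)

module Topology (X : Space) where
  open Space X

  _∩_ : (Pt → Set) → (Pt → Set) → Pt → Set
  (U ∩ V) x = U x × V x

  coderived : Subset Pt → Subset Pt
  coderived A x = ¬ derived X (λ y → ¬ A y) x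

  derived-mono : ∀ {A B x} → (∀ y → A y → B y) → derived X A x → derived X B x
  derived-mono A⊆B dA U Uo Ux =
    let (y , Uy , Ay , y≢x) = dA U Uo Ux in y , Uy , A⊆B y Ay , y≢x

  derived⊆closure : ∀ {A x} → derived X A x → closure X A x
  derived⊆closure dA U Uo Ux = let (y , Uy , Ay , _) = dA U Uo Ux in y , Uy , Ay

  isolated⇒¬derived : ∀ {A x} → IsOpen (λ y → y ≡ x) → ¬ derived X A x
  isolated⇒¬derived {x = x} isolated dA =
    let (y , y≡x , _ , y≢x) = dA (λ y → y ≡ x) isolated refl in y≢x y≡x

  interior⊆coderived : ∀ {A x} → interior X A x → coderived A x
  interior⊆coderived (U , Uo , Ux , U⊆A) d¬A =
    let (y , Uy , ¬Ay , _) = d¬A U Uo Ux in ¬Ay (U⊆A y Uy)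

  denseIn⇒inhabited : ∀ {U A x} → DenseIn X U A → U x → ∃ λ y → A y
  denseIn⇒inhabited dense Ux =
    let (y , _ , _ , Ay) = dense _ Ux (λ _ → ⊤) open-univ tt in y , Ay

  denseIn⊆closure : ∀ {U A x} → DenseIn X U A → U x → closure X A x
  denseIn⊆closure dense Ux W Wo Wx = let (y , Wy , _ , Ay) = dense _ Ux W Wo Wx in y , Wy , Ay

module Classical (dne : ∀ {ℓ} → DoubleNegationElimination ℓ) (X : Space) where
  open Space X
  open Topology X

  coderived⇒puncturedNbhd : ∀ {A x} → coderived A x →
    Σ (Pt → Set) λ U → IsOpen U × U x × (∀ y → U y → y ≢ x → A y)
  coderived⇒puncturedNbhd cdA = dne λ noNbhd → cdA λ U Uo Ux → dne λ noWitness →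
    noNbhd (U , Uo , Ux , λ y Uy y≢x → dne λ ¬Ay → noWitness (y , Uy , ¬Ay , y≢x))

  crowded⇒avoid : Crowded X → ∀ {U u} → IsOpen U → U u → (x : Pt) → ∃ λ p → U p × p ≢ x
  crowded⇒avoid crowded {U} {u} Uo Uu x = dne λ U⊆x →
    let u≡x = dne λ u≢x → U⊆x (u , Uu , u≢x)
    in crowded x (open-ext U (λ y → y ≡ x)
         (λ y → mk⇔ (λ Uy → dne λ y≢x → U⊆x (y , Uy , y≢x)) (λ { refl → subst U u≡x Uu })) Uo)

  ¬derivedSingleton⇒separatingNbhd : ∀ {x z} → z ≢ x → ¬ derived X (singleton X x) z →
    Σ (Pt → Set) λ S → IsOpen S × S z × ¬ S x
  ¬derivedSingleton⇒separatingNbhd {x} z≢x ¬d = dne λ noNbhd →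
    ¬d λ S So Sz → x , dne (λ ¬Sx → noNbhd (S , So , Sz , ¬Sx)) , lift refl , λ x≡z → z≢x (sym x≡z)

  -- Under T_D a point z ≠ x near x has a neighbourhood missing x, which keeps the
  -- point of A found near z away from x.
  TD-crowded⇒interiorClosure⊆derived : TD X → Crowded X → ∀ {A x} →
    interior X (closure X A) x → derived X A x
  TD-crowded⇒interiorClosure⊆derived td crowded {x = x} (U , Uo , Ux , U⊆clA) W Wo Wx =
    let (T , To , T⇔¬d) = td x
        Tx = Equivalence.from (T⇔¬d x) λ d →
               let (_ , _ , lift y≡x , y≢x) = d (λ _ → ⊤) open-univ tt in y≢x y≡x
        (z , (Wz , Uz , Tz) , z≢x) = crowded⇒avoid crowded
          (open-∩ W (U ∩ T) Wo (open-∩ U T Uo To)) (Wx , Ux , Tx) x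
        (S , So , Sz , ¬Sx) = ¬derivedSingleton⇒separatingNbhd z≢x (Equivalence.to (T⇔¬d z) Tz)
        (y , (Sy , Wy) , Ay) = U⊆clA z Uz (S ∩ W) (open-∩ S W So Wo) (Sz , Wz)
    in y , Wy , Ay , λ y≡x → ¬Sx (subst S y≡x Sy)

  crowded⇒coderivedDerived⊆interiorClosure : Crowded X → ∀ {A x} →
    coderived (derived X A) x → interior X (closure X A) x
  crowded⇒coderivedDerived⊆interiorClosure crowded {A} {x} cd =
    let (U , Uo , Ux , U∖x⊆dA) = coderived⇒puncturedNbhd cd
        U⊆clA : ∀ u → U u → closure X A u
        U⊆clA u Uu W Wo Wu =
          let WU-open = open-∩ W U Wo Uo
              (p , WUp , p≢x) = crowded⇒avoid crowded WU-open (Wu , Uu) x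
              (y , (Wy , _) , Ay) = derived⊆closure (U∖x⊆dA p (proj₂ WUp) p≢x) (W ∩ U) WU-open WUp
          in y , Wy , Ay
    in U , Uo , Ux , U⊆clA

  crowded⇒closureInterior⊆derivedCoderived : Crowded X → ∀ {A x} →
    closure X (interior X A) x → derived X (coderived A) x
  crowded⇒closureInterior⊆derivedCoderived crowded {x = x} clIntA V Vo Vx =
    let (y , Vy , (W , Wo , Wy , W⊆A)) = clIntA V Vo Vx
        VW-open = open-∩ V W Vo Wo
        (p , (Vp , Wp) , p≢x) = crowded⇒avoid crowded VW-open (Vy , Wy) x
    in p , Vp , interior⊆coderived (V ∩ W , VW-open , (Vp , Wp) , λ q VWq → W⊆A q (proj₂ VWq)) , p≢x

  openlyIrresolvable⇒interior : OpenlyIrresolvable X → ∀ {O A x} → IsOpen O → O x →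
    (∀ y → O y → closure X A y) → ∃ λ z → O z × interior X A z
  openlyIrresolvable⇒interior oi {O} {A} {x} Oo Ox O⊆clA = dne λ noInterior →
    oi O Oo (x , Ox)
      ( (λ y → O y × A y) , (λ y → O y × ¬ A y) , (λ _ → proj₁) , (λ _ → proj₁)
      , denseIn⇒inhabited A-dense Ox , denseIn⇒inhabited (¬A-dense noInterior) Ox
      , (λ y OAy O¬Ay → proj₂ O¬Ay (proj₂ OAy)) , A-dense , ¬A-dense noInterior )
    where
    A-dense : DenseIn X O (λ y → O y × A y)
    A-dense z Oz W Wo Wz =
      let (y , (Wy , Oy) , Ay) = O⊆clA z Oz (W ∩ O) (open-∩ W O Wo Oo) (Wz , Oz)
      in y , Wy , Oy , Oy , Ay

    ¬A-dense : ¬ (∃ λ z → O z × interior X A z) → DenseIn X O (λ y → O y × ¬ A y)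
    ¬A-dense noInterior z Oz W Wo Wz = dne λ WO⊆A →
      noInterior (z , Oz , W ∩ O , open-∩ W O Wo Oo , (Wz , Oz) ,
        λ y (Wy , Oy) → dne λ ¬Ay → WO⊆A (y , Wy , Oy , Oy , ¬Ay))

  openlyIrresolvable⇒interiorClosure⊆closureInterior : OpenlyIrresolvable X → ∀ {A x} →
    interior X (closure X A) x → closure X (interior X A) x
  openlyIrresolvable⇒interiorClosure⊆closureInterior oi (U , Uo , Ux , U⊆clA) V Vo Vx =
    let (z , (Uz , Vz) , intA) = openlyIrresolvable⇒interior oi (open-∩ U V Uo Vo) (Ux , Vx)
                                   (λ y UVy → U⊆clA y (proj₁ UVy))
    in z , Vz , intA

  openlyIrresolvable⇒McKinsey-C : OpenlyIrresolvable X → McKinsey-C X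
  openlyIrresolvable⇒McKinsey-C oi _ _ _ = openlyIrresolvable⇒interiorClosure⊆closureInterior oi

  crowded-openlyIrresolvable⇒McKinsey-d : Crowded X → OpenlyIrresolvable X → McKinsey-d X
  crowded-openlyIrresolvable⇒McKinsey-d crowded oi φ v x □◇φ =
    crowded⇒closureInterior⊆derivedCoderived crowded
      (openlyIrresolvable⇒interiorClosure⊆closureInterior oi
        (crowded⇒coderivedDerived⊆interiorClosure crowded □◇φ))

  McKinsey-d⇒crowded : McKinsey-d X → Crowded X
  McKinsey-d⇒crowded m x isolated =
    isolated⇒¬derived isolated (m ⊤ᶠ (λ _ _ → Lift _ ⊤) x (isolated⇒¬derived isolated))

  TD-McKinsey-d⇒openlyIrresolvable : TD X → McKinsey-d X → OpenlyIrresolvable X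
  TD-McKinsey-d⇒openlyIrresolvable td m U Uo (x , Ux) (A , B , _ , _ , _ , _ , disjoint , A-dense , B-dense) =
    let d-dense : ∀ {C} → DenseIn X U C → ∀ y → U y → derived X C y
        d-dense C-dense y Uy = TD-crowded⇒interiorClosure⊆derived td (McKinsey-d⇒crowded m)
                                 (U , Uo , Uy , λ u Uu → denseIn⊆closure C-dense Uu)
        □◇A : coderived (derived X A) x
        □◇A d¬dA = let (y , Uy , ¬dAy , _) = d¬dA U Uo Ux in ¬dAy (d-dense A-dense y Uy)
        (y , Uy , □Ay , _) = m (var 0) (λ _ → A) x □◇A U Uo Ux
    in □Ay (derived-mono (λ z Bz Az → disjoint z Az Bz) (d-dense B-dense y Uy))

  McKinsey-C⇒openlyIrresolvable : McKinsey-C X → OpenlyIrresolvable X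
  McKinsey-C⇒openlyIrresolvable m U Uo (x , Ux) (A , B , _ , _ , _ , _ , disjoint , A-dense , B-dense) =
    let (y , Uy , (S , So , Sy , S⊆A)) =
          m (var 0) (λ _ → A) x (U , Uo , Ux , λ u Uu → denseIn⊆closure A-dense Uu) U Uo Ux
        (w , Sw , _ , Bw) = B-dense y Uy S So Sy
    in disjoint w (S⊆A w Sw) Bw

mainTheorem14 : ({ℓ : Level} → ExcludedMiddle ℓ) → (X : Space) → TD X →
    (McKinsey-d X ⇔ (Crowded X × OpenlyIrresolvable X))
    × (Crowded X →
        (McKinsey-d X ⇔ OpenlyIrresolvable X) × (OpenlyIrresolvable X ⇔ McKinsey-C X))
mainTheorem14 em X td =
    mk⇔ (λ m → McKinsey-d⇒crowded m , TD-McKinsey-d⇒openlyIrresolvable td m)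
        (λ (crowded , oi) → crowded-openlyIrresolvable⇒McKinsey-d crowded oi)
  , λ crowded →
      mk⇔ (TD-McKinsey-d⇒openlyIrresolvable td) (crowded-openlyIrresolvable⇒McKinsey-d crowded)
    , mk⇔ openlyIrresolvable⇒McKinsey-C McKinsey-C⇒openlyIrresolvable
  where open Classical (em⇒dne em) X
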